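{- Let $G$ be a finite group with $\kappa(\mathcal{G}(G))=\delta(\mathcal{G}(G))$. Suppose $G$ is not a cyclic group of prime power order, and let $v\in G$ satisfy $\deg(v)=\delta(\mathcal{G}(G))$. Then: (i) $N(v)$ is a minimum separating set of $\mathcal{G}(G)$; (ii) $v$ has order $2$ in $G$; consequently $|G|$ is even.
   Context: The power graph $\mathcal{G}(G)$ has vertex set $G$, distinct $u,v$ adjacent iff one is a positive integer power of the other. $\delta$ is minimum degree, $N(v)$ is the set of neighbours of $v$. $\kappa(\Gamma)$ is the (vertex) connectivity: the minimum number of vertices whose removal results in a disconnected or trivial graph. A separating set is a set of vertices whose removal increases the number of components; a minimum separating set is one of least cardinality. -}

module Defs where

open import Level using (0ℓ)
open import Data.Nat using (ℕ; zero; suc; _≤_; _∸_; _^_)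
open import Data.Fin using (Fin)
open import Data.Fin.Subset using (Subset; _∈_; _∉_; ∣_∣)
open import Data.Nat.Primality using (Prime)
open import Data.Product using (Σ; ∃; ∃-syntax; _×_; _,_)
open import Data.Sum using (_⊎_)
open import Relation.Nullary using (¬_)
open import Relation.Binary.PropositionalEquality using (_≡_; _≢_)
open import Algebra.Structures using (IsGroup)

-- A finite group of order n, presented on the carrier Fin n with
-- propositional equality (every finite group is isomorphic to one).
record FinGroup : Set where
  field
    n       : ℕ
    _∙_     : Fin n → Fin n → Fin n
    ε       : Fin n
    _⁻¹     : Fin n → Fin n
    isGroup : IsGroup _≡_ _∙_ ε _⁻¹

module _ (G : FinGroup) where
  open FinGroup G

  pow : Fin n → ℕ → Fin n
  pow x zero    = ε
  pow x (suc k) = x ∙ pow x k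

  -- cyclic: generated by a single element (for finite groups ℕ-powers suffice)
  IsCyclic : Set
  IsCyclic = ∃[ g ] ∀ (x : Fin n) → ∃[ k ] x ≡ pow g k

  -- cyclic group of prime power order (p ^ 0 = 1 allowed: the trivial group)
  CyclicPrimePower : Set
  CyclicPrimePower = IsCyclic × (∃[ p ] ∃[ k ] (Prime p × n ≡ p ^ k))

  Adj : Fin n → Fin n → Set
  Adj u v = u ≢ v × ((∃[ k ] v ≡ pow u (suc k)) ⊎ (∃[ k ] u ≡ pow v (suc k)))

  IsNbhd : Fin n → Subset n → Set
  IsNbhd v S = ∀ u → (u ∈ S → Adj v u) × (Adj v u → u ∈ S)

  Deg : Fin n → ℕ → Set
  Deg v d = ∃[ S ] (IsNbhd v S × ∣ S ∣ ≡ d)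

  MinDegree : ℕ → Set
  MinDegree d = (∃[ v ] Deg v d) × (∀ u e → Deg u e → d ≤ e)

  data Reach (X : Subset n) : Fin n → Fin n → Set where
    here : ∀ {a} → a ∉ X → Reach X a a
    step : ∀ {a b c} → a ∉ X → Adj a b → Reach X b c → Reach X a c

  Disconnected : Subset n → Set
  Disconnected X = ∃[ a ] ∃[ b ] (a ∉ X × b ∉ X × ¬ Reach X a b)

  Cuts : Subset n → Set
  Cuts X = Disconnected X ⊎ (n ∸ ∣ X ∣ ≤ 1)

  Connectivity : ℕ → Set
  Connectivity k = (∃[ X ] (Cuts X × ∣ X ∣ ≡ k)) × (∀ X → Cuts X → k ≤ ∣ X ∣)

  -- separating set: removal increases the number of components.
  -- 𝒢(G) is connected (ε is adjacent to every other vertex), so this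
  -- means exactly that 𝒢(G) − X has at least two components.
  Separating : Subset n → Set
  Separating X = Disconnected X

  MinSeparating : Subset n → Set
  MinSeparating X = Separating X × (∀ Y → Separating Y → ∣ X ∣ ≤ ∣ Y ∣)

module Submission where

-- The key fact is that N(v) ∪ {v} is not all of G.  Otherwise every cut
-- has at least n - 1 vertices, which forces 𝒢(G) to be complete
-- (two non-adjacent vertices a, b are separated by G ∖ {a, b}); and a
-- group whose power graph is complete is cyclic of prime power order:
-- any finite set of elements lies in one cyclic subgroup, and for a
-- generator g and distinct primes p, q dividing n the elements g^(n/p)
-- and g^(n/q) would not be powers of one another.  So pick w ∉ N(v) ∪ {v}.
--   (i)  N(v) separates v from w, and it is no larger than any cut.
--   (ii) v ≠ ε, since ε is adjacent to everything; if v² ≠ ε then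
--        u = v⁻¹ ≠ v lies in N(v) and is a "twin" of v (each is a power of
--        the other), so N(v) ∖ {u} still separates v from w: a smaller
--        cut.  Finally x ↦ x v is a fixed-point-free involution, so n is even.

open import Defs
open import Level using (0ℓ)
open import Data.Nat as ℕ
  using (ℕ; zero; suc; _+_; _*_; _∸_; _≤_; _<_; s<s⁻¹; NonZero; ≢-nonZero⁻¹)
open import Data.Nat.Properties
  using (_≟_; <-cmp; ≤-antisym; ≤-trans; ≤-<-trans; <⇒≱; m≤n+m; +-suc; *-comm; *-suc; *-assoc;
         *-cancelˡ-≡; suc-injective; m≤n⇒∃[o]m+o≡n; n<1+n)
open import Data.Nat.Divisibility
  using (_∣_; divides; ∣-refl; ∣-trans; _∣0; m∣m*n; n∣m*n; ∣m∣n⇒∣m+n; %-presˡ-∣; ∣n∣m%n⇒∣m)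
open import Data.Nat.DivMod using (_%_; _/_; m≡m%n+[m/n]*n; m%n<n)
open import Data.Nat.ListAction using (product)
open import Data.Nat.Primality using (Prime; prime[2]; prime⇒irreducible; ¬prime[1])
open import Data.Nat.Primality.Factorisation using (factorise; PrimeFactorisation)
open import Data.Fin using (Fin; toℕ; fromℕ<) renaming (_≟_ to _≟ᶠ_)
open import Data.Fin.Properties
  using (pigeonhole; any?; injective⇒≤; toℕ-injective; toℕ-fromℕ<; toℕ<n; nonZeroIndex; ¬∀⟶∃¬)
open import Data.Fin.Subset
  using (Subset; inside; outside; _∈_; _∉_; ∣_∣; _─_; _-_; ∁; ⁅_⁆; ⊤; _⊆_; Nonempty)
open import Data.Fin.Subset.Properties
  using (_∈?_; nonempty?; Empty-unique; ∣⊥∣≡0; ∣⊤∣≡n; ∈⊤; x∈⁅x⁆; x∉⁅y⁆⇒x≢y; x≢y⇒x∉⁅y⁆;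
         x∉p⇒x∈∁p; x∈∁p⇒x∉p; ∣∁p∣≡n∸∣p∣; ∣⁅x⁆∣≡1; p⊆q⇒∣p∣≤∣q∣; ⊆-antisym; p─⊥≡p; p─q⊆p;
         x∈p∧x≢y⇒x∈p-y; x∈p⇒∣p-x∣<∣p∣)
open import Data.Vec using (_∷_; here; there)
open import Data.List using (List; []; _∷_; allFin)
open import Data.List.Relation.Unary.All as All using (All; []; _∷_)
open import Data.List.Membership.Propositional.Properties using (∈-allFin)
open import Data.Product using (∃-syntax; _×_; _,_; proj₁; proj₂)
open import Data.Sum using (_⊎_; inj₁; inj₂)
open import Relation.Nullary using (¬_; Dec; yes; no; contradiction)
open import Relation.Nullary.Decidable as Dec using (¬?; _×-dec_; _⊎-dec_)
open import Relation.Binary.Definitions using (tri<; tri≈; tri>)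
open import Relation.Binary.PropositionalEquality
open import Function using (_∘′_)
open import Algebra.Bundles using (Group)
open import Algebra.Structures using (IsGroup)
import Algebra.Properties.Group as GroupProperties

open ≡-Reasoning

least-witness : (Q : ℕ → Set) → (∀ j → Dec (Q j)) → ∀ m → Q m →
                ∃[ k ] (Q k × (∀ j → j < k → ¬ Q j))
least-witness Q Q? m q with Q? 0
... | yes q₀ = 0 , q₀ , λ _ ()
... | no ¬q₀ with m
...   | zero = contradiction q ¬q₀
...   | suc m′ with least-witness (λ j → Q (suc j)) (λ j → Q? (suc j)) m′ q
...     | k , qk , below = suc k , qk , λ { zero _ → ¬q₀ ; (suc j) j<k → below j (s<s⁻¹ j<k) }

x∈p─q⇒x∉q : ∀ {m} {x : Fin m} {p q : Subset m} → x ∈ p ─ q → x ∉ q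
x∈p─q⇒x∉q {p = inside ∷ _}  {inside ∷ _} () here
x∈p─q⇒x∉q {p = outside ∷ _} {inside ∷ _} () here
x∈p─q⇒x∉q {p = _ ∷ _} {_ ∷ _} (there x∈p─q) (there x∈q) = x∈p─q⇒x∉q x∈p─q x∈q

x∈p-y⇒x≢y : ∀ {m} {x y : Fin m} {p : Subset m} → x ∈ p - y → x ≢ y
x∈p-y⇒x≢y x∈p-y = x∉⁅y⁆⇒x≢y (x∈p─q⇒x∉q x∈p-y)

x∈p∧x∉p-y⇒x≡y : ∀ {m} {x y : Fin m} {p : Subset m} → x ∈ p → x ∉ p - y → x ≡ y
x∈p∧x∉p-y⇒x≡y {x = x} {y} x∈p x∉p-y with x ≟ᶠ y
... | yes x≡y = x≡y
... | no  x≢y = contradiction (x∈p∧x≢y⇒x∈p-y x∈p x≢y) x∉p-y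

∣∁⁅x⁆∣≡m∸1 : ∀ {m} (x : Fin m) → ∣ ∁ ⁅ x ⁆ ∣ ≡ m ∸ 1
∣∁⁅x⁆∣≡m∸1 {m} x = trans (∣∁p∣≡n∸∣p∣ ⁅ x ⁆) (cong (m ∸_) (∣⁅x⁆∣≡1 x))

x∈p⇒suc∣p-x∣≡∣p∣ : ∀ {m} {x : Fin m} {p : Subset m} → x ∈ p → suc ∣ p - x ∣ ≡ ∣ p ∣
x∈p⇒suc∣p-x∣≡∣p∣ {p = inside ∷ p}  here        = cong (λ q → suc ∣ q ∣) (p─⊥≡p p)
x∈p⇒suc∣p-x∣≡∣p∣ {p = inside ∷ _}  (there x∈p) = cong suc (x∈p⇒suc∣p-x∣≡∣p∣ x∈p)
x∈p⇒suc∣p-x∣≡∣p∣ {p = outside ∷ _} (there x∈p) = x∈p⇒suc∣p-x∣≡∣p∣ x∈p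

nonempty : ∀ {m} {p : Subset m} {c} → ∣ p ∣ ≡ suc c → Nonempty p
nonempty {m} {p} ∣p∣≡1+c with nonempty? p
... | yes ne = ne
... | no ¬ne = contradiction (trans (sym ∣p∣≡1+c) (trans (cong ∣_∣ (Empty-unique ¬ne)) (∣⊥∣≡0 m))) λ ()

-- A fixed-point-free involution f on Fin m splits every f-closed subset
-- into pairs {x, f x}; hence such a subset, and Fin m itself, has even size.
module FixedPointFreeInvolution {m : ℕ} (f : Fin m → Fin m)
         (involutive : ∀ x → f (f x) ≡ x) (fixed-point-free : ∀ x → f x ≢ x) where

  Closed : Subset m → Set
  Closed X = ∀ {x} → x ∈ X → f x ∈ X

  private
    f-injective : ∀ {x y} → f x ≡ f y → x ≡ y
    f-injective {x} {y} fx≡fy = trans (sym (involutive x)) (trans (cong f fx≡fy) (involutive y))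

  remove-pair-size : ∀ {X x} → Closed X → x ∈ X → suc (suc ∣ X - x - f x ∣) ≡ ∣ X ∣
  remove-pair-size {X} {x} closed x∈X = begin
    suc (suc ∣ X - x - f x ∣) ≡⟨ cong suc (x∈p⇒suc∣p-x∣≡∣p∣ fx∈X-x) ⟩
    suc ∣ X - x ∣             ≡⟨ x∈p⇒suc∣p-x∣≡∣p∣ x∈X ⟩
    ∣ X ∣                     ∎
    where
    fx∈X-x : f x ∈ X - x
    fx∈X-x = x∈p∧x≢y⇒x∈p-y (closed x∈X) (fixed-point-free x)

  remove-pair-closed : ∀ {X x} → Closed X → Closed (X - x - f x)
  remove-pair-closed {X} {x} closed {z} z∈Y =
    x∈p∧x≢y⇒x∈p-y (x∈p∧x≢y⇒x∈p-y (closed z∈X) fz≢x) (λ fz≡fx → z≢x (f-injective fz≡fx))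
    where
    z∈X-x : z ∈ X - x
    z∈X-x = p─q⊆p (X - x) ⁅ f x ⁆ z∈Y
    z∈X : z ∈ X
    z∈X = p─q⊆p X ⁅ x ⁆ z∈X-x
    z≢x : z ≢ x
    z≢x = x∈p-y⇒x≢y z∈X-x
    fz≢x : f z ≢ x
    fz≢x fz≡x = x∈p-y⇒x≢y z∈Y (trans (sym (involutive z)) (cong f fz≡x))

  closed-even : ∀ c (X : Subset m) → ∣ X ∣ ≡ c → Closed X → 2 ∣ c
  closed-even zero X _ _ = 2 ∣0
  closed-even (suc c) X ∣X∣≡1+c closed with nonempty ∣X∣≡1+c
  ... | x , x∈X with c | trans (remove-pair-size closed x∈X) ∣X∣≡1+c
  ...   | zero   | ()
  ...   | suc c′ | size = ∣m∣n⇒∣m+n ∣-refl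
          (closed-even c′ (X - x - f x) (suc-injective (suc-injective size)) (remove-pair-closed closed))

  even : 2 ∣ m
  even = closed-even m ⊤ (∣⊤∣≡n m) (λ _ → ∈⊤)

PrimePower : ℕ → Set
PrimePower n = ∃[ p ] ∃[ k ] (Prime p × n ≡ p ℕ.^ k)

TwoPrimeDivisors : ℕ → Set
TwoPrimeDivisors n = ∃[ p ] ∃[ q ] (Prime p × Prime q × p ≢ q × (p ∣ n) × (q ∣ n))

product-dichotomy : ∀ ps → All Prime ps → PrimePower (product ps) ⊎ TwoPrimeDivisors (product ps)
product-dichotomy [] [] = inj₁ (2 , 0 , prime[2] , refl)
product-dichotomy (p ∷ ps) (prime-p ∷ primes) with product-dichotomy ps primes
... | inj₁ (q , zero , _ , ps≡1) = inj₁ (p , 1 , prime-p , cong (p *_) ps≡1)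
... | inj₁ (q , suc k , prime-q , ps≡q^k) with p ≟ q
...   | yes refl = inj₁ (p , suc (suc k) , prime-p , cong (p *_) ps≡q^k)
...   | no p≢q   = inj₂ (p , q , prime-p , prime-q , p≢q , m∣m*n (product ps) ,
                         ∣-trans (subst (q ∣_) (sym ps≡q^k) (m∣m*n (q ℕ.^ k))) (n∣m*n p))
product-dichotomy (p ∷ ps) (_ ∷ _) | inj₂ (q , r , prime-q , prime-r , q≢r , q∣ps , r∣ps) =
  inj₂ (q , r , prime-q , prime-r , q≢r , ∣-trans q∣ps (n∣m*n p) , ∣-trans r∣ps (n∣m*n p))

prime-power-dichotomy : ∀ n .{{_ : NonZero n}} → PrimePower n ⊎ TwoPrimeDivisors n
prime-power-dichotomy n =
  subst (λ k → PrimePower k ⊎ TwoPrimeDivisors k) (sym isFactorisation)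
        (product-dichotomy factors factorsPrime)
  where open PrimeFactorisation (factorise n)

equal-primes : ∀ {n A B p q} .{{_ : NonZero n}} → Prime p → Prime q →
               n ≡ A * p → n ≡ B * q → B ∣ A → p ≡ q
equal-primes {n} {A} {zero} _ _ _ n≡0 _ = contradiction n≡0 (≢-nonZero⁻¹ n)
equal-primes {n} {A} {B@(suc _)} {p} {q} prime-p prime-q n≡Ap n≡Bq (divides c A≡cB)
  with prime⇒irreducible prime-q (divides c (sym cp≡q))
  where
  cp≡q : c * p ≡ q
  cp≡q = *-cancelˡ-≡ (c * p) q B (begin
    B * (c * p) ≡⟨ sym (*-assoc B c p) ⟩
    B * c * p   ≡⟨ cong (_* p) (*-comm B c) ⟩
    c * B * p   ≡⟨ cong (_* p) (sym A≡cB) ⟩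
    A * p       ≡⟨ sym n≡Ap ⟩
    n           ≡⟨ n≡Bq ⟩
    B * q       ∎)
... | inj₁ p≡1 = contradiction (subst Prime p≡1 prime-p) ¬prime[1]
... | inj₂ p≡q = p≡q

module _ (G : FinGroup) where
  open FinGroup G
  open IsGroup isGroup using (assoc; identityˡ; identityʳ; inverseˡ; inverseʳ)

  private
    group : Group 0ℓ 0ℓ
    group = record { isGroup = isGroup }

    infix 30 _^_
    _^_ : Fin n → ℕ → Fin n
    _^_ = pow G

  open GroupProperties group using (∙-cancelˡ; ⁻¹-injective; ε⁻¹≈ε)

  ^-+ : ∀ x a b → x ^ (a + b) ≡ x ^ a ∙ x ^ b
  ^-+ x zero    b = sym (identityˡ _)
  ^-+ x (suc a) b = trans (cong (x ∙_) (^-+ x a b)) (sym (assoc _ _ _))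

  ε^ : ∀ k → ε ^ k ≡ ε
  ε^ zero    = refl
  ε^ (suc k) = trans (identityˡ _) (ε^ k)

  ^-1 : ∀ x → x ^ 1 ≡ x
  ^-1 = identityʳ

  ^-* : ∀ x a b → x ^ (a * b) ≡ (x ^ a) ^ b
  ^-* x a zero    = cong (x ^_) (*-comm a 0)
  ^-* x a (suc b) = begin
    x ^ (a * suc b)       ≡⟨ cong (x ^_) (*-suc a b) ⟩
    x ^ (a + a * b)       ≡⟨ ^-+ x a (a * b) ⟩
    x ^ a ∙ x ^ (a * b)   ≡⟨ cong (x ^ a ∙_) (^-* x a b) ⟩
    x ^ a ∙ (x ^ a) ^ b   ∎

  ^-mod : ∀ {x m} → x ^ suc m ≡ ε → ∀ k → x ^ k ≡ x ^ (k % suc m)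
  ^-mod {x} {m} period k = begin
    x ^ k                             ≡⟨ cong (x ^_) (m≡m%n+[m/n]*n k (suc m)) ⟩
    x ^ (r + q * suc m)               ≡⟨ ^-+ x r (q * suc m) ⟩
    x ^ r ∙ x ^ (q * suc m)           ≡⟨ cong (λ y → x ^ r ∙ y) multiple ⟩
    x ^ r ∙ ε                         ≡⟨ identityʳ _ ⟩
    x ^ r                             ∎
    where
    r q : ℕ
    r = k % suc m
    q = k / suc m
    multiple : x ^ (q * suc m) ≡ ε
    multiple = begin
      x ^ (q * suc m)   ≡⟨ cong (x ^_) (*-comm q (suc m)) ⟩
      x ^ (suc m * q)   ≡⟨ ^-* x (suc m) q ⟩
      (x ^ suc m) ^ q   ≡⟨ cong (_^ q) period ⟩
      ε ^ q             ≡⟨ ε^ q ⟩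
      ε                 ∎

  ^-gap : ∀ {x r s} → x ^ r ≡ x ^ s → r < s → ∃[ k ] (suc r + k ≡ s × x ^ suc k ≡ ε)
  ^-gap {x} {r} {s} x^r≡x^s r<s with m≤n⇒∃[o]m+o≡n r<s
  ... | k , r+1+k≡s = k , r+1+k≡s , ∙-cancelˡ (x ^ r) _ _ (begin
    x ^ r ∙ x ^ suc k   ≡⟨ sym (^-+ x r (suc k)) ⟩
    x ^ (r + suc k)     ≡⟨ cong (x ^_) (trans (+-suc r k) r+1+k≡s) ⟩
    x ^ s               ≡⟨ sym x^r≡x^s ⟩
    x ^ r               ≡⟨ sym (identityʳ _) ⟩
    x ^ r ∙ ε           ∎)

  -- Every element has a positive period (pigeonhole on x^0, …, x^n).
  periodic : ∀ x → ∃[ m ] x ^ suc m ≡ ε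
  periodic x with pigeonhole (n<1+n n) (λ i → x ^ toℕ i)
  ... | _ , _ , i<j , x^i≡x^j with ^-gap x^i≡x^j i<j
  ...   | k , _ , x^1+k≡ε = k , x^1+k≡ε

  -- x has order suc m: suc m is the least positive exponent giving ε.
  HasOrder : Fin n → ℕ → Set
  HasOrder x m = x ^ suc m ≡ ε × (∀ j → j < m → x ^ suc j ≢ ε)

  order : ∀ x → ∃[ m ] HasOrder x m
  order x = least-witness (λ j → x ^ suc j ≡ ε) (λ j → x ^ suc j ≟ᶠ ε)
                          (proj₁ (periodic x)) (proj₂ (periodic x))

  order-no-repeat : ∀ {x m a b} → HasOrder x m → a < b → b < suc m → x ^ a ≢ x ^ b
  order-no-repeat {a = a} (_ , least) a<b b<o x^a≡x^b with ^-gap x^a≡x^b a<b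
  ... | k , refl , x^1+k≡ε = least k (≤-<-trans (m≤n+m k a) (s<s⁻¹ b<o)) x^1+k≡ε

  order-injective : ∀ {x m r s} → HasOrder x m → r < suc m → s < suc m → x ^ r ≡ x ^ s → r ≡ s
  order-injective {r = r} {s} ord r<o s<o x^r≡x^s with <-cmp r s
  ... | tri< r<s _ _ = contradiction x^r≡x^s (order-no-repeat ord r<s s<o)
  ... | tri≈ _ r≡s _ = r≡s
  ... | tri> _ _ s<r = contradiction (sym x^r≡x^s) (order-no-repeat ord s<r r<o)

  inverse-is-power : ∀ x y → x ∙ y ≡ ε → y ≢ ε → ∃[ j ] y ≡ x ^ suc j
  inverse-is-power x y xy≡ε y≢ε with periodic x
  ... | zero  , x≡ε = contradiction (∙-cancelˡ x y ε (trans xy≡ε (sym x≡ε))) y≢ε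
  ... | suc j , x^2+j≡ε = j , ∙-cancelˡ x y (x ^ suc j) (trans xy≡ε (sym x^2+j≡ε))

  IsPosPower : Fin n → Fin n → Set
  IsPosPower x y = ∃[ k ] y ≡ x ^ suc k

  posPower-trans : ∀ {x y z} → IsPosPower x y → IsPosPower y z → IsPosPower x z
  posPower-trans {x} (a , y≡x^1+a) (b , z≡y^1+b) =
    b + a * suc b , trans z≡y^1+b (trans (cong (_^ suc b) y≡x^1+a) (sym (^-* x (suc a) (suc b))))

  power⇒posPower : ∀ {x y m} → x ^ suc m ≡ ε → ∀ k → y ≡ x ^ k → IsPosPower x y
  power⇒posPower {m = m} period zero    y≡ε      = m , trans y≡ε (sym period)
  power⇒posPower          _      (suc k) y≡x^1+k = k , y≡x^1+k

  -- Adjacency is decidable: y is a positive power of x iff y is among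
  -- x^0, …, x^m for a period suc m of x.
  posPower? : ∀ x y → Dec (IsPosPower x y)
  posPower? x y with periodic x
  ... | m , period = Dec.map′
    (λ (i , y≡x^i) → power⇒posPower {m = m} period (toℕ i) y≡x^i)
    (λ (k , y≡x^1+k) → reduce (suc k) y≡x^1+k)
    (any? (λ (i : Fin (suc m)) → y ≟ᶠ x ^ toℕ i))
    where
    reduce : ∀ k → y ≡ x ^ k → ∃[ i ] y ≡ x ^ toℕ i
    reduce k y≡x^k = fromℕ< (m%n<n k (suc m)) ,
      trans y≡x^k (trans (^-mod period k) (cong (x ^_) (sym (toℕ-fromℕ< (m%n<n k (suc m))))))

  adj? : ∀ a b → Dec (Adj G a b)
  adj? a b = ¬? (a ≟ᶠ b) ×-dec (posPower? a b ⊎-dec posPower? b a)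

  Complete : Set
  Complete = ∀ a b → a ≢ b → Adj G a b

  -- In a complete power graph any finite list of elements consists of powers
  -- of a single element: adding x to a list of powers of g, either x is a
  -- power of g, or g (hence every earlier element) is a power of x.
  common-base : Complete → ∀ xs → ∃[ g ] All (λ x → ∃[ k ] x ≡ g ^ k) xs
  common-base complete [] = ε , []
  common-base complete (x ∷ xs) with common-base complete xs
  ... | g , powers with x ≟ᶠ g
  ...   | yes x≡g = g , (1 , trans x≡g (sym (^-1 g))) ∷ powers
  ...   | no x≢g with complete g x (λ g≡x → x≢g (sym g≡x))
  ...     | _ , inj₁ (k , x≡g^1+k) = g , (suc k , x≡g^1+k) ∷ powers
  ...     | _ , inj₂ (k , g≡x^1+k) = x , (1 , sym (^-1 x)) ∷ All.map rebase powers
    where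
    rebase : ∀ {y} → ∃[ j ] y ≡ g ^ j → ∃[ j ] y ≡ x ^ j
    rebase (j , y≡g^j) = suc k * j , trans y≡g^j (trans (cong (_^ j) g≡x^1+k) (sym (^-* x (suc k) j)))

  complete⇒cyclic : Complete → IsCyclic G
  complete⇒cyclic complete with common-base complete (allFin n)
  ... | g , powers = g , λ x → All.lookup powers (∈-allFin x)

  -- For a generator g the order of g is n, so exponents of g are determined
  -- modulo n; consequently divisibility by a divisor of n can be read off.
  module Generator (g : Fin n) (generates : ∀ x → ∃[ k ] x ≡ g ^ k) where

    private
      m : ℕ
      m = proj₁ (order g)

      g-order : HasOrder g m
      g-order = proj₂ (order g)

      log : Fin n → Fin (suc m)
      log x = fromℕ< (m%n<n (proj₁ (generates x)) (suc m))

      g^log : ∀ x → g ^ toℕ (log x) ≡ x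
      g^log x = begin
        g ^ toℕ (log x)   ≡⟨ cong (g ^_) (toℕ-fromℕ< (m%n<n k (suc m))) ⟩
        g ^ (k % suc m)   ≡⟨ sym (^-mod (proj₁ g-order) k) ⟩
        g ^ k             ≡⟨ sym x≡g^k ⟩
        x                 ∎
        where
        k : ℕ
        k = proj₁ (generates x)
        x≡g^k : x ≡ g ^ k
        x≡g^k = proj₂ (generates x)

      -- g^0, …, g^m are distinct and exhaust G.
      order≡n : suc m ≡ n
      order≡n = ≤-antisym (injective⇒≤ power-injective) (injective⇒≤ log-injective)
        where
        power-injective : ∀ {i j : Fin (suc m)} → g ^ toℕ i ≡ g ^ toℕ j → i ≡ j
        power-injective {i} {j} = toℕ-injective ∘′ order-injective g-order (toℕ<n i) (toℕ<n j)
        log-injective : ∀ {x y} → log x ≡ log y → x ≡ y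
        log-injective {x} {y} logx≡logy =
          trans (sym (g^log x)) (trans (cong (λ i → g ^ toℕ i) logx≡logy) (g^log y))

    exponent-divisor : ∀ {d s t} → d ∣ n → d ∣ t → g ^ s ≡ g ^ t → d ∣ s
    exponent-divisor {d} {s} {t} d∣n d∣t g^s≡g^t =
      ∣n∣m%n⇒∣m d∣o (subst (d ∣_) (sym s%o≡t%o) (%-presˡ-∣ d∣t d∣o))
      where
      d∣o : d ∣ suc m
      d∣o = subst (d ∣_) (sym order≡n) d∣n
      s%o≡t%o : s % suc m ≡ t % suc m
      s%o≡t%o = order-injective g-order (m%n<n s (suc m)) (m%n<n t (suc m))
        (trans (sym (^-mod (proj₁ g-order) s)) (trans g^s≡g^t (^-mod (proj₁ g-order) t)))

  -- A group with complete power graph is cyclic of prime power order: for a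
  -- generator g and n = A·p = B·q with distinct primes p, q, neither of
  -- g^A, g^B is a positive power of the other.
  complete⇒cyclicPrimePower : Complete → CyclicPrimePower G
  complete⇒cyclicPrimePower complete with complete⇒cyclic complete
  ... | g , generates = (g , generates) , prime-power (prime-power-dichotomy n)
    where
    open Generator g generates
    instance
      n≢0 : NonZero n
      n≢0 = nonZeroIndex ε

    incomparable : ∀ A B {p q} → Prime p → Prime q → p ≢ q →
                   n ≡ A * p → n ≡ B * q → ¬ IsPosPower (g ^ B) (g ^ A)
    incomparable A B {q = q} prime-p prime-q p≢q n≡Ap n≡Bq (j , g^A≡g^B^1+j) =
      p≢q (equal-primes prime-p prime-q n≡Ap n≡Bq B∣A)
      where
      B∣A : B ∣ A
      B∣A = exponent-divisor (divides q (trans n≡Bq (*-comm B q))) (m∣m*n (suc j))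
                             (trans g^A≡g^B^1+j (sym (^-* g B (suc j))))

    prime-power : PrimePower n ⊎ TwoPrimeDivisors n → PrimePower n
    prime-power (inj₁ n-prime-power) = n-prime-power
    prime-power (inj₂ (p , q , prime-p , prime-q , p≢q , divides A n≡Ap , divides B n≡Bq))
      with g ^ A ≟ᶠ g ^ B
    ... | yes g^A≡g^B = contradiction (0 , trans g^A≡g^B (sym (^-1 (g ^ B))))
                                      (incomparable A B prime-p prime-q p≢q n≡Ap n≡Bq)
    ... | no g^A≢g^B with complete (g ^ A) (g ^ B) g^A≢g^B
    ...   | _ , inj₁ B-power-of-A = contradiction B-power-of-A
                                      (incomparable B A prime-q prime-p (p≢q ∘′ sym) n≡Bq n≡Ap)
    ...   | _ , inj₂ A-power-of-B = contradiction A-power-of-B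
                                      (incomparable A B prime-p prime-q p≢q n≡Ap n≡Bq)

  -- Separation in 𝒢(G) − X: a vertex set C that contains every neighbour
  -- outside X of its members cannot be left along a path avoiding X.

  ClosedOutside : Subset n → (Fin n → Set) → Set
  ClosedOutside X C = ∀ {c d} → C c → Adj G c d → d ∉ X → C d

  reach-start : ∀ {X a b} → Reach G X a b → a ∉ X
  reach-start (here a∉X)     = a∉X
  reach-start (step a∉X _ _) = a∉X

  reach-closed : ∀ {X C a b} → ClosedOutside X C → Reach G X a b → C a → C b
  reach-closed closed (here _)         Ca = Ca
  reach-closed closed (step _ adj path) Ca = reach-closed closed path (closed Ca adj (reach-start path))

  separated : ∀ {X C a b} → ClosedOutside X C → a ∉ X → b ∉ X → C a → ¬ C b → Disconnected G X
  separated closed a∉X b∉X Ca ¬Cb = _ , _ , a∉X , b∉X , λ path → ¬Cb (reach-closed closed path Ca)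

  nonadjacent⇒disconnected : ∀ {a b} → a ≢ b → ¬ Adj G a b → Disconnected G (∁ ⁅ a ⁆ - b)
  nonadjacent⇒disconnected {a} {b} a≢b ¬adj =
    separated {C = _≡ a} closed a∉X (λ b∈X → x∈p-y⇒x≢y b∈X refl) refl (a≢b ∘′ sym)
    where
    ∈-removed : ∀ {x} → x ∈ ∁ ⁅ a ⁆ - b → x ∈ ∁ ⁅ a ⁆
    ∈-removed = p─q⊆p (∁ ⁅ a ⁆) ⁅ b ⁆
    a∉X : a ∉ ∁ ⁅ a ⁆ - b
    a∉X a∈X = x∈∁p⇒x∉p (∈-removed a∈X) (x∈⁅x⁆ a)
    closed : ClosedOutside (∁ ⁅ a ⁆ - b) (_≡ a)
    closed {d = d} refl adj d∉X with d ≟ᶠ a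
    ... | yes refl = contradiction refl (proj₁ adj)
    ... | no d≢a = contradiction (subst (Adj G a) (x∈p∧x∉p-y⇒x≡y (x∉p⇒x∈∁p (x≢y⇒x∉⁅y⁆ d≢a)) d∉X) adj) ¬adj

  highly-connected⇒complete : (∀ X → Cuts G X → n ∸ 1 ≤ ∣ X ∣) → Complete
  highly-connected⇒complete bound a b a≢b with adj? a b
  ... | yes adj = adj
  ... | no ¬adj = contradiction (bound X (inj₁ (nonadjacent⇒disconnected a≢b ¬adj))) (<⇒≱ small)
    where
    X : Subset n
    X = ∁ ⁅ a ⁆ - b
    small : ∣ X ∣ < n ∸ 1
    small = subst (∣ X ∣ <_) (∣∁⁅x⁆∣≡m∸1 a) (x∈p⇒∣p-x∣<∣p∣ (x∉p⇒x∈∁p (x≢y⇒x∉⁅y⁆ (a≢b ∘′ sym))))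

  -- If S is no larger than any cut and G is not cyclic of prime power
  -- order, then some vertex w lies outside S ∪ {v}: otherwise every cut has
  -- at least n - 1 vertices and 𝒢(G) would be complete.
  outside-vertex : ∀ {S} v → ¬ CyclicPrimePower G → (∀ X → Cuts G X → ∣ S ∣ ≤ ∣ X ∣) →
                   ∃[ w ] (w ∉ S × w ≢ v)
  outside-vertex {S} v ¬cpp bound =
    let w , w∉S∪v = ¬∀⟶∃¬ n _ (λ w → (w ∈? S) ⊎-dec (w ≟ᶠ v)) ¬covered
    in  w , w∉S∪v ∘′ inj₁ , w∉S∪v ∘′ inj₂
    where
    ¬covered : ¬ (∀ w → w ∈ S ⊎ w ≡ v)
    ¬covered covered = ¬cpp (complete⇒cyclicPrimePower
                              (highly-connected⇒complete λ X cut → ≤-trans n∸1≤∣S∣ (bound X cut)))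
      where
      ∁v⊆S : ∁ ⁅ v ⁆ ⊆ S
      ∁v⊆S {w} w∈∁v with covered w
      ... | inj₁ w∈S = w∈S
      ... | inj₂ refl = contradiction (x∈⁅x⁆ w) (x∈∁p⇒x∉p w∈∁v)
      n∸1≤∣S∣ : n ∸ 1 ≤ ∣ S ∣
      n∸1≤∣S∣ = subst (_≤ ∣ S ∣) (∣∁⁅x⁆∣≡m∸1 v) (p⊆q⇒∣p∣≤∣q∣ ∁v⊆S)

  -- The neighbourhood of a vertex is unique (Subset equality is extensional).
  nbhd-unique : ∀ {v S T} → IsNbhd G v S → IsNbhd G v T → S ≡ T
  nbhd-unique NS NT = ⊆-antisym (λ {x} x∈S → proj₂ (NT x) (proj₁ (NS x) x∈S))
                                (λ {x} x∈T → proj₂ (NS x) (proj₁ (NT x) x∈T))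

  v∉nbhd : ∀ {v S} → IsNbhd G v S → v ∉ S
  v∉nbhd {v} N v∈S = proj₁ (proj₁ (N v) v∈S) refl

  nbhd-minSeparating : ∀ {v w S} → IsNbhd G v S → (∀ X → Cuts G X → ∣ S ∣ ≤ ∣ X ∣) →
                       w ∉ S → w ≢ v → MinSeparating G S
  nbhd-minSeparating {v} {S = S} N bound w∉S w≢v =
    separated {C = _≡ v} closed (v∉nbhd N) w∉S refl w≢v , λ Y Y-separates → bound Y (inj₁ Y-separates)
    where
    closed : ClosedOutside S (_≡ v)
    closed refl adj d∉S = contradiction (proj₂ (N _) adj) d∉S

  -- ε is adjacent to every other vertex, since ε is a positive power of each u.
  ε-adjacent : ∀ {u} → u ≢ ε → Adj G ε u
  ε-adjacent {u} u≢ε = u≢ε ∘′ sym , inj₂ (let m , u^1+m≡ε = periodic u in m , sym u^1+m≡ε)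

  non-neighbour⇒≢ε : ∀ {v w S} → IsNbhd G v S → w ∉ S → w ≢ v → v ≢ ε
  non-neighbour⇒≢ε {w = w} N w∉S w≢v refl = w∉S (proj₂ (N w) (ε-adjacent w≢v))

  twin-adj : ∀ {u v c} → IsPosPower u v → IsPosPower v u → Adj G u c → c ≢ v → Adj G v c
  twin-adj v∈⟨u⟩ u∈⟨v⟩ (_ , inj₁ c∈⟨u⟩) c≢v = c≢v ∘′ sym , inj₁ (posPower-trans u∈⟨v⟩ c∈⟨u⟩)
  twin-adj v∈⟨u⟩ u∈⟨v⟩ (_ , inj₂ u∈⟨c⟩) c≢v = c≢v ∘′ sym , inj₂ (posPower-trans u∈⟨c⟩ v∈⟨u⟩)

  -- Hence a twin u of v can be dropped from N(v): {v, u} is still cut off.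
  twin-removed-disconnects : ∀ {u v w S} → IsNbhd G v S → IsPosPower u v → IsPosPower v u →
                             u ∈ S → w ∉ S → w ≢ v → Disconnected G (S - u)
  twin-removed-disconnects {u} {v} {w} {S} N v∈⟨u⟩ u∈⟨v⟩ u∈S w∉S w≢v =
    separated {C = λ c → c ≡ v ⊎ c ≡ u} closed (v∉nbhd N ∘′ ⊆S) (w∉S ∘′ ⊆S) (inj₁ refl) ¬Cw
    where
    ⊆S : S - u ⊆ S
    ⊆S = p─q⊆p S ⁅ u ⁆
    closed : ClosedOutside (S - u) (λ c → c ≡ v ⊎ c ≡ u)
    closed (inj₁ refl) adj d∉S-u = inj₂ (x∈p∧x∉p-y⇒x≡y (proj₂ (N _) adj) d∉S-u)
    closed {d = d} (inj₂ refl) adj d∉S-u with d ≟ᶠ v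
    ... | yes d≡v = inj₁ d≡v
    ... | no  d≢v = inj₂ (x∈p∧x∉p-y⇒x≡y (proj₂ (N d) (twin-adj v∈⟨u⟩ u∈⟨v⟩ adj d≢v)) d∉S-u)
    ¬Cw : ¬ (w ≡ v ⊎ w ≡ u)
    ¬Cw (inj₁ w≡v) = w≢v w≡v
    ¬Cw (inj₂ refl) = w∉S u∈S

  -- Part (ii): otherwise u = v⁻¹ ≠ v is a twin of v in N(v), and N(v) - u
  -- would be a cut smaller than N(v).
  nbhd-involution : ∀ {v w S} → IsNbhd G v S → (∀ X → Cuts G X → ∣ S ∣ ≤ ∣ X ∣) →
                    w ∉ S → w ≢ v → v ∙ v ≡ ε
  nbhd-involution {v} {S = S} N bound w∉S w≢v with v ∙ v ≟ᶠ ε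
  ... | yes vv≡ε = vv≡ε
  ... | no  vv≢ε = contradiction (bound (S - u) (inj₁ smaller-cut)) (<⇒≱ (x∈p⇒∣p-x∣<∣p∣ u∈S))
    where
    u : Fin n
    u = v ⁻¹
    v≢ε : v ≢ ε
    v≢ε = non-neighbour⇒≢ε N w∉S w≢v
    u≢ε : u ≢ ε
    u≢ε u≡ε = v≢ε (⁻¹-injective (trans u≡ε (sym ε⁻¹≈ε)))
    u≢v : u ≢ v
    u≢v u≡v = vv≢ε (trans (cong (v ∙_) (sym u≡v)) (inverseʳ v))
    u∈⟨v⟩ : IsPosPower v u
    u∈⟨v⟩ = inverse-is-power v u (inverseʳ v) u≢ε
    v∈⟨u⟩ : IsPosPower u v
    v∈⟨u⟩ = inverse-is-power u v (inverseˡ v) v≢ε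
    u∈S : u ∈ S
    u∈S = proj₂ (N u) (u≢v ∘′ sym , inj₁ u∈⟨v⟩)
    smaller-cut : Disconnected G (S - u)
    smaller-cut = twin-removed-disconnects N v∈⟨u⟩ u∈⟨v⟩ u∈S w∉S w≢v

  -- An element of order 2 makes n even: x ↦ x ∙ v is a fixed-point-free involution.
  involution⇒even : ∀ {v} → v ≢ ε → v ∙ v ≡ ε → 2 ∣ n
  involution⇒even {v} v≢ε vv≡ε = FixedPointFreeInvolution.even (_∙ v) involutive fixed-point-free
    where
    involutive : ∀ x → (x ∙ v) ∙ v ≡ x
    involutive x = trans (assoc x v v) (trans (cong (x ∙_) vv≡ε) (identityʳ x))
    fixed-point-free : ∀ x → x ∙ v ≢ x
    fixed-point-free x xv≡x = v≢ε (∙-cancelˡ x v ε (trans xv≡x (sym (identityʳ x))))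

theorem6p2 : (G : FinGroup) →
    (∃[ k ] (Connectivity G k × MinDegree G k)) →
    ¬ CyclicPrimePower G →
    (v : Fin (FinGroup.n G)) →
    (∃[ d ] (Deg G v d × MinDegree G d)) →
    ((S : Subset (FinGroup.n G)) → IsNbhd G v S → MinSeparating G S)
    × (v ≢ FinGroup.ε G × FinGroup._∙_ G v v ≡ FinGroup.ε G)
    × (2 ∣ FinGroup.n G)
theorem6p2 G (k , (_ , κ≤cut) , (u , deg-u≡k) , _) ¬cpp v (d , (S₀ , N₀ , ∣S₀∣≡d) , _ , δ≤deg) =
  let w , w∉S₀ , w≢v = outside-vertex G v ¬cpp bound
      v≢ε  = non-neighbour⇒≢ε G N₀ w∉S₀ w≢v
      vv≡ε = nbhd-involution G N₀ bound w∉S₀ w≢v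
  in  (λ S N → subst (MinSeparating G) (nbhd-unique G N₀ N) (nbhd-minSeparating G N₀ bound w∉S₀ w≢v))
    , (v≢ε , vv≡ε)
    , involution⇒even G v≢ε vv≡ε
  where
  -- |N(v)| = δ ≤ κ ≤ |X| for every cut X
  bound : ∀ X → Cuts G X → ∣ S₀ ∣ ≤ ∣ X ∣
  bound X cut = subst (_≤ ∣ X ∣) (sym ∣S₀∣≡d) (≤-trans (δ≤deg u k deg-u≡k) (κ≤cut X cut))
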